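{- Let $n \geq 3$ be an integer and let $p_1, p_2, \ldots, p_r$ be the distinct prime factors of $n$. Then $$|C'_n \setminus CP_n| = \sum_{k=1}^{r}(-1)^{k+1}\left(\sum_{1 \leq i_1<i_2 < \dots < i_k \leq r} 2^{\frac{n}{p_{i_1}p_{i_2} \cdots p_{i_k}}-1}\right).$$
   Context: For $n \ge 2$, $C_n$ denotes the set of all $n\times n$ $(0,1)$-matrices $A=(a_{ij})$ with $a_{i,i+1}=1$ for $1\le i\le n-1$, last row $(a_{n1},\dots,a_{nn})\in\{0,1\}^n$ arbitrary, and all other entries $0$. These are the $(0,1)$ companion matrices of polynomials $x^n-\sum_{i=0}^{n-1}a_i x^i$ with $a_i\in\{0,1\}$, where $a_{n,i}=a_{i-1}$. Thus $|C_n|=2^n$. The adjacency digraph $D(A)$ of $A$ has vertex set $\{1,\dots,n\}$ and an edge $(i,j)$ if and only if $a_{ij}=1$. A nonnegative matrix is irreducible if $D(A)$ is strongly connected. A nonnegative matrix $A$ is primitive if $A^m$ has all entries positive for some positive integer $m$; equivalently, $A$ is irreducible and the gcd of the lengths of the elementary cycles of $D(A)$ is $1$. $C'_n$ is the set of irreducible matrices in $C_n$, and $CP_n$ is the set of primitive matrices in $C_n$. -}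

module Defs where

open import Data.Nat using (ℕ; zero; suc; _+_; _*_; _∸_; _<_; _≟_)
open import Data.Nat.DivMod using (_/_)
open import Data.Nat.Divisibility using (_∣_)
open import Data.Nat.Primality using (Prime)
open import Data.Bool using (Bool; true; false)
open import Data.Fin using (Fin; toℕ)
import Data.Fin as F
open import Data.Vec using (Vec; lookup)
open import Data.List using (List; []; _∷_; _++_; map; length)
open import Data.Nat.ListAction using (product)
open import Data.List.Membership.Propositional using (_∈_)
open import Data.List.Relation.Unary.Unique.Propositional using (Unique)
open import Data.Integer as ℤ using (ℤ; +_)
open import Data.Product using (Σ; _×_; ∃)
open import Function.Bundles using (_⇔_)
open import Relation.Binary.PropositionalEquality using (_≡_)
open import Relation.Binary.Construct.Closure.ReflexiveTransitive using (Star)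
open import Relation.Nullary using (yes; no)

-- A row vector (a_{n1},...,a_{nn}) ∈ {0,1}^n determines one matrix of C_n.
-- Entry (i,j) (0-indexed here) of the companion matrix with last row `a`:
--   1 if j = i+1 (superdiagonal), a_j if i is the last row, 0 otherwise.
compEntry : (n : ℕ) → Vec Bool n → Fin n → Fin n → Bool
compEntry n a i j with suc (toℕ i) ≟ toℕ j
... | yes _ = true
... | no _ with suc (toℕ i) ≟ n
...   | yes _ = lookup a j
...   | no _ = false

Matrix : ℕ → Set
Matrix n = Fin n → Fin n → ℕ

b2n : Bool → ℕ
b2n true = 1
b2n false = 0

compMatrix : (n : ℕ) → Vec Bool n → Matrix n
compMatrix n a i j = b2n (compEntry n a i j)

sumFin : (n : ℕ) → (Fin n → ℕ) → ℕ
sumFin zero f = 0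
sumFin (suc n) f = f F.zero + sumFin n (λ i → f (F.suc i))

matMul : (n : ℕ) → Matrix n → Matrix n → Matrix n
matMul n A B i j = sumFin n (λ k → A i k * B k j)

identity : (n : ℕ) → Matrix n
identity n i j with toℕ i ≟ toℕ j
... | yes _ = 1
... | no _ = 0

matPow : (n : ℕ) → Matrix n → ℕ → Matrix n
matPow n A zero = identity n
matPow n A (suc m) = matMul n A (matPow n A m)

Edge : (n : ℕ) → Vec Bool n → Fin n → Fin n → Set
Edge n a i j = compEntry n a i j ≡ true

Irreducible : (n : ℕ) → Vec Bool n → Set
Irreducible n a = ∀ (i j : Fin n) → Star (Edge n a) i j

Primitive : (n : ℕ) → Vec Bool n → Set
Primitive n a = Σ ℕ λ m → (0 < m) × (∀ (i j : Fin n) → 0 < matPow n (compMatrix n a) m i j)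

HasCard : {A : Set} → (A → Set) → ℕ → Set
HasCard {A} P N = Σ (List A) λ L → Unique L × (length L ≡ N) × (∀ x → (x ∈ L) ⇔ P x)

DistinctPrimeFactors : ℕ → List ℕ → Set
DistinctPrimeFactors n ps = Unique ps × (∀ p → (p ∈ ps) ⇔ (Prime p × p ∣ n))

subsets : List ℕ → List (List ℕ)
subsets [] = [] ∷ []
subsets (x ∷ xs) = subsets xs ++ map (x ∷_) (subsets xs)

-- division with a total default at 0 (never used at 0 here)
quot : ℕ → ℕ → ℕ
quot n zero = 0
quot n (suc d) = n / suc d

term : ℕ → List ℕ → ℤ
term n [] = + 0
term n S@(_ ∷ _) = (ℤ.-1ℤ ℤ.^ (length S + 1)) ℤ.* (+ (2 Data.Nat.^ (quot n (product S) ∸ 1)))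

sumℤ : List ℤ → ℤ
sumℤ [] = + 0
sumℤ (x ∷ xs) = x ℤ.+ sumℤ xs

inclExcl : ℕ → List ℕ → ℤ
inclExcl n ps = sumℤ (map (term n) (subsets ps))

module Submission where

open import Defs
open import Data.Nat using (ℕ; _≤_)
open import Data.Integer using (+_)
open import Data.Vec using (Vec)
open import Data.Bool using (Bool)
open import Data.List using (List)
open import Data.Product using (Σ; _×_)
open import Relation.Nullary using (¬_)
open import Relation.Binary.PropositionalEquality using (_≡_)

open import Data.Nat using (zero; suc; _+_; _*_; _∸_; _^_; _<_; _/_; _%_; _≟_; z≤n; s≤s)
open import Data.Nat.Base using (nonTrivial⇒n>1)
open import Data.Nat.Properties
  using ( +-assoc; +-comm; +-suc; +-identityʳ; *-identityʳ; *-assoc; *-zeroʳ; +-commutativeSemigroup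
        ; ≤-refl; ≤-reflexive; ≤-trans; ≤-pred; <-irrefl; n≤1+n; 1+n≰n; 1+n≢0; m≤m+n; m≤n+m; m∸n≤m
        ; +-mono-≤; *-monoˡ-≤; +-cancelˡ-≤; *-cancelʳ-≤; +-∸-assoc; m+[n∸m]≡n; m∸n+n≡m )
open import Data.Nat.DivMod using (m*n/n≡m; m≡m%n+[m/n]*n; m%n<n; %-distribˡ-+; %-remove-+ˡ; m<n⇒m%n≡m)
open import Data.Nat.Divisibility using (_∣_; _∣?_; divides; ∣⇒≤; ∣m+n∣m⇒∣n; n∣m*n; m∣m*n; ∣-trans; 0∣⇒≡0)
open import Data.Nat.GCD using (gcd; gcd-GCD; gcd[m,n]∣m; gcd[m,n]∣n; module Bézout)
open import Data.Nat.Primality using (Prime; euclidsLemma; prime⇒nonTrivial; productOfPrimes≥1)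
open import Data.Nat.Primality.Factorisation using (factorise; factorisationHasAllPrimeFactors)
open import Data.Nat.ListAction using (product)
open import Data.Nat.ListAction.Properties using (∈⇒∣product)
import Data.Nat.Tactic.RingSolver as ℕSolver
open import Data.Integer as ℤ using (ℤ; -1ℤ; _-_)
import Data.Integer.Properties as ℤP
import Data.Integer.Tactic.RingSolver as ℤSolver
open import Data.Bool using (true; false; _∧_; _∨_; not; T)
open import Data.Bool.Properties using (T-≡; T-∧; ∧-comm; ∧-assoc; ∧-zeroʳ; ∧-idem; ∧-inverseʳ; ∧-identityʳ)
open import Data.Bool.ListAction using (all; any)
open import Data.Unit using (tt)
open import Data.Empty using (⊥-elim)
open import Data.Sum using (_⊎_; inj₁; inj₂)
open import Data.Product using (∃; _,_; proj₁; proj₂; uncurry)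
open import Data.Fin using (Fin; toℕ; fromℕ; fromℕ<) renaming (zero to fzero; suc to fsuc)
open import Data.Fin.Properties using (toℕ-injective; toℕ<n; toℕ≤pred[n]; toℕ≤n; toℕ-fromℕ; toℕ-fromℕ<)
open import Data.Fin.Subset using (Subset; inside; outside; _⊆_; ∣_∣) renaming (_∈_ to _∈ₛ_)
open import Data.Fin.Subset.Properties using (_⊆?_)
open import Data.Vec as Vec using ([]; _∷_; lookup; here; there)
open import Data.Vec.Properties using (∷-injectiveʳ; []=⇒lookup; lookup⇒[]=)
open import Data.List using ([]; _∷_; _++_; map; length; foldr; filterᵇ; allFin)
open import Data.List.Properties using (map-++; map-∘; map-cong; map-cong-local)
open import Data.List.Membership.Propositional using (_∈_; find)
open import Data.List.Membership.Propositional.Properties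
  using (∈-++⁺ˡ; ∈-++⁺ʳ; ∈-++⁻; ∈-map⁺; ∈-map⁻; ∈-filter⁺; ∈-filter⁻; ∈-allFin)
open import Data.List.Relation.Unary.Any as Any using (Any; here; there)
open import Data.List.Relation.Unary.Any.Properties using (any⁺; any⁻)
open import Data.List.Relation.Unary.All as All using (All; []; _∷_)
open import Data.List.Relation.Unary.AllPairs using ([]; _∷_)
open import Data.List.Relation.Unary.Unique.Propositional using (Unique)
import Data.List.Relation.Unary.Unique.Propositional.Properties as Unique
open import Function using (_∘_)
open import Function.Bundles using (_⇔_; mk⇔; Equivalence)
open import Relation.Nullary using (yes; no; does)
open import Relation.Nullary.Decidable using (Dec; T?; does-⇔)
open import Relation.Binary.PropositionalEquality using (refl; sym; trans; cong; cong₂; subst; subst₂; module ≡-Reasoning)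
open import Relation.Binary.Construct.Closure.ReflexiveTransitive using (Star; ε; _◅_)
open import Algebra.Properties.CommutativeSemigroup +-commutativeSemigroup using (interchange)

-- A ∈ C_n (n ≥ 2) is determined by its last row a.  Its digraph D(A) has the edges
-- i → i + 1 and last → k for every k with a_k = 1, so its cycles are exactly
-- last → k → … → last, of length n − k.
-- The theorem is inclusion–exclusion over the prime factors of n of these counts.

count : {A : Set} → (A → Bool) → List A → ℕ
count f []       = 0
count f (x ∷ xs) = b2n (f x) + count f xs

count-cong : {A : Set} {f g : A → Bool} (xs : List A) → (∀ x → f x ≡ g x) → count f xs ≡ count g xs
count-cong []       f≗g = refl
count-cong (x ∷ xs) f≗g = cong₂ _+_ (cong b2n (f≗g x)) (count-cong xs f≗g)

count-++ : {A : Set} (f : A → Bool) (xs ys : List A) → count f (xs ++ ys) ≡ count f xs + count f ys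
count-++ f []       ys = refl
count-++ f (x ∷ xs) ys = trans (cong (λ c → b2n (f x) + c) (count-++ f xs ys)) (sym (+-assoc (b2n (f x)) _ _))

count-map : {A B : Set} (f : B → Bool) (h : A → B) (xs : List A) → count f (map h xs) ≡ count (f ∘ h) xs
count-map f h []       = refl
count-map f h (x ∷ xs) = cong (λ c → b2n (f (h x)) + c) (count-map f h xs)

count-false : {A : Set} (xs : List A) → count (λ _ → false) xs ≡ 0
count-false []       = refl
count-false (x ∷ xs) = count-false xs

count-split : {A : Set} (f g : A → Bool) (xs : List A) →
  count f xs ≡ count (λ x → f x ∧ g x) xs + count (λ x → f x ∧ not (g x)) xs
count-split f g []       = refl
count-split {A} f g (x ∷ xs) = begin
  b2n (f x) + count f xs
    ≡⟨ cong₂ _+_ (split (f x) (g x)) (count-split f g xs) ⟩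
  (b2n (f x ∧ g x) + b2n (f x ∧ not (g x))) + (count fg xs + count f¬g xs)
    ≡⟨ interchange (b2n (f x ∧ g x)) (b2n (f x ∧ not (g x))) (count fg xs) (count f¬g xs) ⟩
  (b2n (f x ∧ g x) + count fg xs) + (b2n (f x ∧ not (g x)) + count f¬g xs) ∎
  where
  open ≡-Reasoning
  fg f¬g : A → Bool
  fg  y = f y ∧ g y
  f¬g y = f y ∧ not (g y)
  split : ∀ b c → b2n b ≡ b2n (b ∧ c) + b2n (b ∧ not c)
  split false c     = refl
  split true  true  = refl
  split true  false = refl

does-sound : ∀ {P : Set} (P? : Dec P) → T (does P?) → P
does-sound (yes p) _ = p

does-complete : ∀ {P : Set} (P? : Dec P) → P → T (does P?)
does-complete (yes _) _  = tt
does-complete (no ¬p) p  = ¬p p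

length-filterᵇ : {A : Set} (f : A → Bool) (xs : List A) → length (filterᵇ f xs) ≡ count f xs
length-filterᵇ f []       = refl
length-filterᵇ f (x ∷ xs) with f x
... | true  = cong suc (length-filterᵇ f xs)
... | false = length-filterᵇ f xs

hasCard-count : {A : Set} {P : A → Set} {f : A → Bool} {xs : List A} →
  Unique xs → (∀ x → x ∈ xs) → (∀ x → T (f x) ⇔ P x) → HasCard P (count f xs)
hasCard-count {f = f} {xs} unique complete decides =
  filterᵇ f xs , Unique.filter⁺ (T? ∘ f) unique , length-filterᵇ f xs ,
  λ x → mk⇔ (λ x∈ → Equivalence.to (decides x) (proj₂ (∈-filter⁻ (T? ∘ f) {xs = xs} x∈)))
            (λ px → ∈-filter⁺ (T? ∘ f) (complete x) (Equivalence.from (decides x) px))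

sumℤ-++ : (xs ys : List ℤ) → sumℤ (xs ++ ys) ≡ sumℤ xs ℤ.+ sumℤ ys
sumℤ-++ []       ys = sym (ℤP.+-identityˡ (sumℤ ys))
sumℤ-++ (x ∷ xs) ys = trans (cong (λ t → x ℤ.+ t) (sumℤ-++ xs ys)) (sym (ℤP.+-assoc x (sumℤ xs) (sumℤ ys)))

sumℤ-neg : {A : Set} (f : A → ℤ) (xs : List A) → sumℤ (map (λ x → ℤ.- f x) xs) ≡ ℤ.- sumℤ (map f xs)
sumℤ-neg f []       = refl
sumℤ-neg f (x ∷ xs) = trans (cong (λ t → ℤ.- f x ℤ.+ t) (sumℤ-neg f xs)) (sym (ℤP.neg-distrib-+ (f x) _))

sum-subsets-∷ : (f : List ℕ → ℤ) (x : ℕ) (ps : List ℕ) →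
  sumℤ (map f (subsets (x ∷ ps))) ≡ sumℤ (map f (subsets ps)) ℤ.+ sumℤ (map (f ∘ (x ∷_)) (subsets ps))
sum-subsets-∷ f x ps = begin
  sumℤ (map f (subsets ps ++ map (x ∷_) (subsets ps)))
    ≡⟨ cong sumℤ (map-++ f (subsets ps) _) ⟩
  sumℤ (map f (subsets ps) ++ map f (map (x ∷_) (subsets ps)))
    ≡⟨ sumℤ-++ (map f (subsets ps)) _ ⟩
  sumℤ (map f (subsets ps)) ℤ.+ sumℤ (map f (map (x ∷_) (subsets ps)))
    ≡⟨ cong (λ t → sumℤ (map f (subsets ps)) ℤ.+ sumℤ t) (sym (map-∘ (subsets ps))) ⟩
  sumℤ (map f (subsets ps)) ℤ.+ sumℤ (map (f ∘ (x ∷_)) (subsets ps)) ∎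
  where open ≡-Reasoning

∧-not-swap : ∀ b c q → (b ∧ not c) ∧ q ≡ (b ∧ q) ∧ not c
∧-not-swap false _ _ = refl
∧-not-swap true  c q = ∧-comm (not c) q

∧-not-∨ : ∀ b c q → (b ∧ not c) ∧ not q ≡ b ∧ not (q ∨ c)
∧-not-∨ false _ _     = refl
∧-not-∨ true  c true  = ∧-zeroʳ (not c)
∧-not-∨ true  c false = ∧-identityʳ (not c)

∧-∨-absorb : ∀ b q c → (b ∧ (q ∨ c)) ∧ c ≡ b ∧ c
∧-∨-absorb false _     _ = refl
∧-∨-absorb true  true  _ = refl
∧-∨-absorb true  false c = ∧-idem c

∧-∨-not : ∀ b q c → (b ∧ (q ∨ c)) ∧ not c ≡ (b ∧ q) ∧ not c
∧-∨-not false _     _ = refl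
∧-∨-not true  true  _ = refl
∧-∨-not true  false c = ∧-inverseʳ c

module InclusionExclusion {A : Set} (univ : List A) (Q : ℕ → A → Bool) where

  allOf anyOf : List ℕ → A → Bool
  allOf S a = all (λ x → Q x a) S
  anyOf S a = any (λ x → Q x a) S

  #_ : (A → Bool) → ℤ
  # f = + count f univ

  #-split : (f g : A → Bool) → # f ≡ # (λ a → f a ∧ g a) ℤ.+ # (λ a → f a ∧ not (g a))
  #-split f g = trans (cong +_ (count-split f g univ)) (ℤP.pos-+ (count (λ a → f a ∧ g a) univ) _)

  #-cong : {f g : A → Bool} → (∀ a → f a ≡ g a) → # f ≡ # g
  #-cong f≗g = cong +_ (count-cong univ f≗g)

  signedCount : (A → Bool) → List ℕ → ℤ
  signedCount g S = -1ℤ ℤ.^ length S ℤ.* # (λ a → g a ∧ allOf S a)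

  signedCount-∷ : ∀ g x S → signedCount g (x ∷ S) ≡ ℤ.- signedCount (λ a → g a ∧ Q x a) S
  signedCount-∷ g x S = begin
    (-1ℤ ℤ.* s) ℤ.* # (λ a → g a ∧ (Q x a ∧ allOf S a))
      ≡⟨ cong₂ ℤ._*_ (ℤP.-1*i≡-i s) (#-cong (λ a → sym (∧-assoc (g a) (Q x a) (allOf S a)))) ⟩
    ℤ.- s ℤ.* # (λ a → (g a ∧ Q x a) ∧ allOf S a)
      ≡⟨ sym (ℤP.neg-distribˡ-* s _) ⟩
    ℤ.- signedCount (λ a → g a ∧ Q x a) S ∎
    where
    open ≡-Reasoning
    s : ℤ
    s = -1ℤ ℤ.^ length S

  #-avoid : (g q r : A → Bool) → # (λ a → g a ∧ not (q a ∨ r a)) ≡ # (λ a → g a ∧ not (r a)) - # (λ a → (g a ∧ q a) ∧ not (r a))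
  #-avoid g q r = begin
    # avoid-both                                    ≡⟨ cancel (# avoid-r-with-q) (# avoid-both) ⟩
    (# avoid-r-with-q ℤ.+ # avoid-both) - # avoid-r-with-q
      ≡⟨ cong (λ t → t - # avoid-r-with-q) split ⟨
    # (λ a → g a ∧ not (r a)) - # avoid-r-with-q    ∎
    where
    open ≡-Reasoning
    avoid-both avoid-r-with-q : A → Bool
    avoid-both     a = g a ∧ not (q a ∨ r a)
    avoid-r-with-q a = (g a ∧ q a) ∧ not (r a)
    cancel : ∀ y z → z ≡ (y ℤ.+ z) - y
    cancel = ℤSolver.solve-∀
    split : # (λ a → g a ∧ not (r a)) ≡ # avoid-r-with-q ℤ.+ # avoid-both
    split = trans (#-split (λ a → g a ∧ not (r a)) q)
                  (cong₂ ℤ._+_ (#-cong (λ a → ∧-not-swap (g a) (r a) (q a))) (#-cong (λ a → ∧-not-∨ (g a) (r a) (q a))))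

  #-union : (h q r : A → Bool) → # (λ a → h a ∧ (q a ∨ r a)) ≡ # (λ a → h a ∧ r a) ℤ.+ # (λ a → (h a ∧ q a) ∧ not (r a))
  #-union h q r = trans (#-split (λ a → h a ∧ (q a ∨ r a)) r)
    (cong₂ ℤ._+_ (#-cong (λ a → ∧-∨-absorb (h a) (q a) (r a))) (#-cong (λ a → ∧-∨-not (h a) (q a) (r a))))

  sieve : ∀ g ps → # (λ a → g a ∧ not (anyOf ps a)) ≡ sumℤ (map (signedCount g) (subsets ps))
  sieve g [] = sym (trans (ℤP.+-identityʳ _) (ℤP.*-identityˡ _))
  sieve g (x ∷ ps) = begin
    # (λ a → g a ∧ not (Q x a ∨ anyOf ps a))
      ≡⟨ #-avoid g (Q x) (anyOf ps) ⟩
    # (λ a → g a ∧ not (anyOf ps a)) - # (λ a → gx a ∧ not (anyOf ps a))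
      ≡⟨ cong₂ _-_ (sieve g ps) (sieve gx ps) ⟩
    sumℤ (map (signedCount g) (subsets ps)) - sumℤ (map (signedCount gx) (subsets ps))
      ≡⟨ cong (λ t → sumℤ (map (signedCount g) (subsets ps)) ℤ.+ t) (sumℤ-neg (signedCount gx) (subsets ps)) ⟨
    sumℤ (map (signedCount g) (subsets ps)) ℤ.+ sumℤ (map (λ S → ℤ.- signedCount gx S) (subsets ps))
      ≡⟨ cong (λ t → sumℤ (map (signedCount g) (subsets ps)) ℤ.+ sumℤ t)
              (map-cong (λ S → signedCount-∷ g x S) (subsets ps)) ⟨
    sumℤ (map (signedCount g) (subsets ps)) ℤ.+ sumℤ (map (signedCount g ∘ (x ∷_)) (subsets ps))
      ≡⟨ sum-subsets-∷ (signedCount g) x ps ⟨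
    sumℤ (map (signedCount g) (subsets (x ∷ ps))) ∎
    where
    open ≡-Reasoning
    gx : A → Bool
    gx a = g a ∧ Q x a

  unionTerm : (A → Bool) → List ℕ → ℤ
  unionTerm h []      = + 0
  unionTerm h (x ∷ S) = signedCount (λ a → h a ∧ Q x a) S

  -- Those
  -- having Q x but no Q y (y ∈ ps) are counted by the sieve formula, which yields
  -- exactly the terms of the sub-selections starting with x.
  inclusionExclusion : ∀ h ps → # (λ a → h a ∧ anyOf ps a) ≡ sumℤ (map (unionTerm h) (subsets ps))
  inclusionExclusion h [] = cong +_ (trans (count-cong univ (λ a → ∧-zeroʳ (h a))) (count-false univ))
  inclusionExclusion h (x ∷ ps) = begin
    # (λ a → h a ∧ (Q x a ∨ anyOf ps a))
      ≡⟨ #-union h (Q x) (anyOf ps) ⟩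
    # (λ a → h a ∧ anyOf ps a) ℤ.+ # (λ a → (h a ∧ Q x a) ∧ not (anyOf ps a))
      ≡⟨ cong₂ ℤ._+_ (inclusionExclusion h ps) (sieve (λ a → h a ∧ Q x a) ps) ⟩
    sumℤ (map (unionTerm h) (subsets ps)) ℤ.+ sumℤ (map (unionTerm h ∘ (x ∷_)) (subsets ps))
      ≡⟨ sum-subsets-∷ (unionTerm h) x ps ⟨
    sumℤ (map (unionTerm h) (subsets (x ∷ ps))) ∎
    where open ≡-Reasoning

allVectors : (m : ℕ) → List (Vec Bool m)
allVectors zero    = [] ∷ []
allVectors (suc m) = map (true Vec.∷_) (allVectors m) ++ map (false Vec.∷_) (allVectors m)

allVectors-complete : ∀ {m} (a : Vec Bool m) → a ∈ allVectors m
allVectors-complete []           = here refl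
allVectors-complete (true ∷ a)  = ∈-++⁺ˡ (∈-map⁺ (true Vec.∷_) (allVectors-complete a))
allVectors-complete (false ∷ a) = ∈-++⁺ʳ _ (∈-map⁺ (false Vec.∷_) (allVectors-complete a))

allVectors-unique : ∀ m → Unique (allVectors m)
allVectors-unique zero    = [] ∷ []
allVectors-unique (suc m) =
  Unique.++⁺ (Unique.map⁺ ∷-injectiveʳ (allVectors-unique m)) (Unique.map⁺ ∷-injectiveʳ (allVectors-unique m)) disjoint
  where
  disjoint : ∀ {v} → ¬ (v ∈ map (true Vec.∷_) (allVectors m) × v ∈ map (false Vec.∷_) (allVectors m))
  disjoint (v∈t , v∈f) with ∈-map⁻ (true Vec.∷_) v∈t | ∈-map⁻ (false Vec.∷_) v∈f
  ... | _ , _ , refl | _ , _ , ()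

count-allVectors : ∀ {m} (f : Vec Bool (suc m) → Bool) →
  count f (allVectors (suc m)) ≡ count (f ∘ (true Vec.∷_)) (allVectors m) + count (f ∘ (false Vec.∷_)) (allVectors m)
count-allVectors {m} f = trans (count-++ f (map (true Vec.∷_) (allVectors m)) _)
  (cong₂ _+_ (count-map f (true Vec.∷_) (allVectors m)) (count-map f (false Vec.∷_) (allVectors m)))

count-subsets : ∀ {m} (M : Subset m) → count (λ a → does (a ⊆? M)) (allVectors m) ≡ 2 ^ ∣ M ∣
count-subsets []            = refl
count-subsets {suc m} (inside ∷ M)  = trans (count-allVectors (λ a → does (a ⊆? inside ∷ M)))
  (cong₂ _+_ (count-subsets M) (trans (count-subsets M) (sym (+-identityʳ _))))
count-subsets {suc m} (outside ∷ M) = trans (count-allVectors (λ a → does (a ⊆? outside ∷ M)))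
  (cong₂ _+_ (count-false (allVectors m)) (count-subsets M))

count-subsets-with-zero : ∀ {m} (M : Subset m) →
  count (λ a → lookup a fzero ∧ does (a ⊆? inside ∷ M)) (allVectors (suc m)) ≡ 2 ^ ∣ M ∣
count-subsets-with-zero {m} M = trans (count-allVectors (λ a → lookup a fzero ∧ does (a ⊆? inside ∷ M)))
  (trans (cong₂ _+_ (count-subsets M) (count-false (allVectors m))) (+-identityʳ _))

CycleDivisor : ℕ → {m : ℕ} → Vec Bool m → Set
CycleDivisor d {m} a = ∀ k → lookup a k ≡ true → d ∣ m ∸ toℕ k

multiples : ℕ → (m : ℕ) → Subset m
multiples d zero    = []
multiples d (suc m) = does (d ∣? suc m) ∷ multiples d m

∈-multiples : ∀ d {m} (k : Fin m) → k ∈ₛ multiples d m ⇔ d ∣ m ∸ toℕ k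
∈-multiples d {suc m} fzero with d ∣? suc m
... | yes d∣ = mk⇔ (λ _ → d∣) (λ _ → here)
... | no  d∤ = mk⇔ (λ ()) (⊥-elim ∘ d∤)
∈-multiples d {suc m} (fsuc k) = mk⇔ (λ { (there k∈) → to k∈ }) (there ∘ from)
  where open Equivalence (∈-multiples d {m} k)

⊆-multiples⇔ : ∀ d {m} (a : Subset m) → a ⊆ multiples d m ⇔ CycleDivisor d a
⊆-multiples⇔ d a = mk⇔
  (λ a⊆ k ak → Equivalence.to (∈-multiples d k) (a⊆ (lookup⇒[]= k a ak)))
  (λ div {k} k∈a → Equivalence.from (∈-multiples d k) (div k ([]=⇒lookup k∈a)))

-- The first position of multiples d (1 + m) stands for the value 1 + m itself.
multiples-∣ : ∀ d m → d ∣ suc m → multiples d (suc m) ≡ inside ∷ multiples d m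
multiples-∣ d m d∣ with d ∣? suc m
... | yes _ = refl
... | no d∤ = ⊥-elim (d∤ d∣)

multiples-∤ : ∀ d m → ¬ d ∣ suc m → multiples d (suc m) ≡ outside ∷ multiples d m
multiples-∤ d m d∤ with d ∣? suc m
... | yes d∣ = ⊥-elim (d∤ d∣)
... | no _   = refl

strictly-between-multiples : ∀ e q r → suc r ≤ e → ¬ suc e ∣ suc r + q * suc e
strictly-between-multiples e q r r<e d∣ =
  1+n≰n (≤-trans (∣⇒≤ (∣m+n∣m⇒∣n (subst (suc e ∣_) (+-comm (suc r) _) d∣) (n∣m*n q))) r<e)

∣multiples∣-block : ∀ e q r → r ≤ e → ∣ multiples (suc e) (r + q * suc e) ∣ ≡ q
∣multiples∣-block e zero    zero _ = refl
∣multiples∣-block e (suc q) zero _ =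
  trans (cong ∣_∣ (multiples-∣ (suc e) (e + q * suc e) (divides (suc q) refl)))
        (cong suc (∣multiples∣-block e q e ≤-refl))
∣multiples∣-block e q (suc r) r<e =
  trans (cong ∣_∣ (multiples-∤ (suc e) (r + q * suc e) (strictly-between-multiples e q r r<e)))
        (∣multiples∣-block e q r (≤-trans (n≤1+n r) r<e))

∣multiples∣ : ∀ e n → suc e ∣ n → ∣ multiples (suc e) n ∣ ≡ n / suc e
∣multiples∣ e n (divides q refl) = trans (∣multiples∣-block e q 0 z≤n) (sym (m*n/n≡m q (suc e)))

count-multiples-with-zero : ∀ d m → d ∣ suc m →
  count (λ a → lookup a fzero ∧ does (a ⊆? multiples d (suc m))) (allVectors (suc m)) ≡
  2 ^ (∣ multiples d (suc m) ∣ ∸ 1)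
count-multiples-with-zero d m d∣ =
  subst (λ M → count (λ a → lookup a fzero ∧ does (a ⊆? M)) (allVectors (suc m)) ≡ 2 ^ (∣ M ∣ ∸ 1))
        (sym (multiples-∣ d m d∣)) (count-subsets-with-zero (multiples d m))

product-∣ : ∀ {S x} → Unique S → All Prime S → All (_∣ x) S → product S ∣ x
product-∣ {[]}    {x} _ _ _ = divides x (sym (*-identityʳ x))
product-∣ {p ∷ S} (p∉S ∷ unique) (p-prime ∷ primes) (p∣x ∷ S∣x) with product-∣ unique primes S∣x
... | divides c x≡c*ΠS with euclidsLemma c (product S) p-prime (subst (p ∣_) x≡c*ΠS p∣x)
...   | inj₁ (divides e c≡e*p) = divides e (trans x≡c*ΠS (trans (cong (_* product S) c≡e*p) (*-assoc e p (product S))))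
...   | inj₂ p∣ΠS = ⊥-elim (All.lookup p∉S (factorisationHasAllPrimeFactors p-prime p∣ΠS primes) refl)

all-does : {A : Set} {P : A → Set} (P? : ∀ x → Dec (P x)) (xs : List A) →
  all (λ x → does (P? x)) xs ≡ does (All.all? P? xs)
all-does P? []       = refl
all-does P? (x ∷ xs) = cong (does (P? x) ∧_) (all-does P? xs)

all-multiples : ∀ {m} (S : List ℕ) → Unique S → All Prime S → (a : Vec Bool m) →
  all (λ p → does (a ⊆? multiples p m)) S ≡ does (a ⊆? multiples (product S) m)
all-multiples {m} S unique primes a =
  trans (all-does (λ p → a ⊆? multiples p m) S) (does-⇔ (mk⇔ to from) (All.all? _ S) (a ⊆? _))
  where
  to : All (λ p → a ⊆ multiples p m) S → a ⊆ multiples (product S) m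
  to a⊆ = Equivalence.from (⊆-multiples⇔ (product S) a) λ k ak →
    product-∣ unique primes (All.map {P = λ p → a ⊆ multiples p m} (λ {p} a⊆p → Equivalence.to (⊆-multiples⇔ p a) a⊆p k ak) a⊆)
  from : a ⊆ multiples (product S) m → All (λ p → a ⊆ multiples p m) S
  from a⊆ = All.tabulate λ {p} p∈S → Equivalence.from (⊆-multiples⇔ p a) λ k ak →
    ∣-trans (∈⇒∣product p∈S) (Equivalence.to (⊆-multiples⇔ (product S) a) a⊆ k ak)

count-multiples : ∀ d m → d ∣ suc m → 0 < d →
  count (λ a → lookup a fzero ∧ does (a ⊆? multiples d (suc m))) (allVectors (suc m)) ≡ 2 ^ (quot (suc m) d ∸ 1)
count-multiples (suc e) m d∣ _ =
  trans (count-multiples-with-zero (suc e) m d∣) (cong (λ c → 2 ^ (c ∸ 1)) (∣multiples∣ e (suc m) d∣))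

data Walk {V : Set} (E : V → V → Set) : ℕ → V → V → Set where
  nil  : ∀ {x} → Walk E 0 x x
  _∷ʷ_ : ∀ {m x y z} → E x y → Walk E m y z → Walk E (suc m) x z

infixr 5 _∷ʷ_

module _ {V : Set} {E : V → V → Set} where

  infixr 5 _++ʷ_

  _++ʷ_ : ∀ {m m' x y z} → Walk E m x y → Walk E m' y z → Walk E (m + m') x z
  nil        ++ʷ w' = w'
  (e ∷ʷ w)   ++ʷ w' = e ∷ʷ (w ++ʷ w')

  walk⇒star : ∀ {m x y} → Walk E m x y → Star E x y
  walk⇒star nil      = ε
  walk⇒star (e ∷ʷ w) = e ◅ walk⇒star w

  walk-map : {F : V → V → Set} → (∀ {x y} → E x y → F x y) → ∀ {m x y} → Walk E m x y → Walk F m x y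
  walk-map f nil      = nil
  walk-map f (e ∷ʷ w) = f e ∷ʷ walk-map f w

  star-last-edge : ∀ {x y} → Star E x y → x ≡ y ⊎ ∃ λ z → E z y
  star-last-edge ε        = inj₁ refl
  star-last-edge (e ◅ es) with star-last-edge es
  ... | inj₁ refl = inj₂ (_ , e)
  ... | inj₂ edge = inj₂ edge

Positive : ∀ {n} → Matrix n → Fin n → Fin n → Set
Positive M i j = 0 < M i j

sumFin-positive⁻ : ∀ n (f : Fin n → ℕ) → 0 < sumFin n f → ∃ λ k → 0 < f k
sumFin-positive⁻ (suc n) f pos with f fzero in eq
... | suc _ = fzero , subst (0 <_) (sym eq) (s≤s z≤n)
... | zero with sumFin-positive⁻ n (λ k → f (fsuc k)) pos
...   | k , fk>0 = fsuc k , fk>0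

sumFin-positive⁺ : ∀ n (f : Fin n → ℕ) k → 0 < f k → 0 < sumFin n f
sumFin-positive⁺ (suc n) f fzero    fk>0 = ≤-trans fk>0 (m≤m+n (f fzero) _)
sumFin-positive⁺ (suc n) f (fsuc k) fk>0 = ≤-trans (sumFin-positive⁺ n (λ k → f (fsuc k)) k fk>0) (m≤n+m _ (f fzero))

*-positive⁻ : ∀ x y → 0 < x * y → 0 < x × 0 < y
*-positive⁻ (suc x) (suc y) _ = s≤s z≤n , s≤s z≤n
*-positive⁻ (suc x) zero pos rewrite *-zeroʳ x = ⊥-elim (<-irrefl refl pos)

*-positive⁺ : ∀ {x y} → 0 < x → 0 < y → 0 < x * y
*-positive⁺ {suc x} {suc y} _ _ = s≤s z≤n

identity-positive⁻ : ∀ {n} (i j : Fin n) → 0 < identity n i j → i ≡ j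
identity-positive⁻ i j pos with toℕ i ≟ toℕ j
... | yes i≡j = toℕ-injective i≡j

identity-positive⁺ : ∀ {n} (i : Fin n) → 0 < identity n i i
identity-positive⁺ i with toℕ i ≟ toℕ i
... | yes _  = s≤s z≤n
... | no i≢i = ⊥-elim (i≢i refl)

matPow-positive⇔walk : ∀ {n} (M : Matrix n) m i j → 0 < matPow n M m i j ⇔ Walk (Positive M) m i j
matPow-positive⇔walk {n} M m i j = mk⇔ (to m i j) (from m i j)
  where
  to : ∀ m i j → 0 < matPow n M m i j → Walk (Positive M) m i j
  to zero    i j pos = subst (Walk (Positive M) 0 i) (identity-positive⁻ i j pos) nil
  to (suc m) i j pos with sumFin-positive⁻ n (λ k → M i k * matPow n M m k j) pos
  ... | k , prod>0 with *-positive⁻ (M i k) _ prod>0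
  ...   | edge , rest = edge ∷ʷ to m k j rest
  from : ∀ m i j → Walk (Positive M) m i j → 0 < matPow n M m i j
  from zero    i .i nil = identity-positive⁺ i
  from (suc m) i j (_∷ʷ_ {y = k} edge w) =
    sumFin-positive⁺ n (λ k → M i k * matPow n M m k j) k (*-positive⁺ edge (from m k j w))

gcdList : List ℕ → ℕ
gcdList = foldr gcd 0

gcdList-∣ : ∀ {d xs} → d ∈ xs → gcdList xs ∣ d
gcdList-∣ {xs = x ∷ xs} (here refl) = gcd[m,n]∣m x (gcdList xs)
gcdList-∣ {xs = x ∷ xs} (there d∈)  = ∣-trans (gcd[m,n]∣n x (gcdList xs)) (gcdList-∣ d∈)

-- Let C ⊆ ℕ contain 0 and be closed under addition (below: the lengths of the
-- closed walks through a fixed vertex).  Modulo n = 1 + n', the residues realised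
-- by C are closed under gcd; hence if C contains n and realises the residue 1,
-- then C contains all sufficiently large numbers.
module AdditivelyClosed (C : ℕ → Set) (C-0 : C 0) (C-+ : ∀ {a b} → C a → C b → C (a + b)) (n' : ℕ) where

  n : ℕ
  n = suc n'

  C-* : ∀ k {a} → C a → C (k * a)
  C-* zero    _  = C-0
  C-* (suc k) ca = C-+ ca (C-* k ca)

  Residue : ℕ → Set
  Residue d = Σ ℕ λ q → C (d + q * n)

  residue : ∀ {d} → C d → Residue d
  residue {d} cd = 0 , subst C (sym (+-identityʳ d)) cd

  residue-+ : ∀ {a b} → Residue a → Residue b → Residue (a + b)
  residue-+ {a} {b} (qa , ca) (qb , cb) = qa + qb , subst C (reassoc a qa b qb n) (C-+ ca cb)
    where
    reassoc : ∀ a qa b qb n → (a + qa * n) + (b + qb * n) ≡ (a + b) + (qa + qb) * n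
    reassoc = ℕSolver.solve-∀

  residue-* : ∀ k {a} → Residue a → Residue (k * a)
  residue-* k {a} (q , ca) = k * q , subst C (distrib k a q n) (C-* k ca)
    where
    distrib : ∀ k a q n → k * (a + q * n) ≡ k * a + (k * q) * n
    distrib = ℕSolver.solve-∀

  residue-shift : ∀ {d} k → Residue (d + k * n) → Residue d
  residue-shift {d} k (q , c) = k + q , subst C (reassoc d k q n) c
    where
    reassoc : ∀ d k q n → (d + k * n) + q * n ≡ d + (k + q) * n
    reassoc = ℕSolver.solve-∀

  -- From d + y·v = x·u: x·u + n'·(y·v) = d + (y·v)·n, so d is realised.
  residue-bezout : ∀ {d u v} x y → d + y * v ≡ x * u → Residue u → Residue v → Residue d
  residue-bezout {d} {u} {v} x y eq ru rv =
    residue-shift (y * v) (subst Residue (trans (cong (_+ n' * (y * v)) (sym eq)) (collect d (y * v) n'))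
      (residue-+ (residue-* x ru) (residue-* n' (residue-* y rv))))
    where
    collect : ∀ d w n' → (d + w) + n' * w ≡ d + w * suc n'
    collect = ℕSolver.solve-∀

  residue-gcd : ∀ {u v} → Residue u → Residue v → Residue (gcd u v)
  residue-gcd {u} {v} ru rv with Bézout.identity (gcd-GCD u v)
  ... | Bézout.+- x y eq = residue-bezout x y eq ru rv
  ... | Bézout.-+ x y eq = residue-bezout y x eq rv ru

  residue-gcdList : ∀ {xs} → All Residue xs → Residue (gcdList xs)
  residue-gcdList []         = residue C-0
  residue-gcdList (rx ∷ rxs) = residue-gcd rx (residue-gcdList rxs)

  -- With s = 1 + t·n ∈ C and n ∈ C, every N ≥ n'·s lies in C: writing
  -- N = k + Q·n (k < n) we have N = k·s + (Q − k·t)·n with Q ≥ k·t.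
  eventually : C n → Residue 1 → Σ ℕ λ B → ∀ N → B ≤ N → C N
  eventually cn (t , cs) = n' * s , λ N B≤N → subst C (decomposition N B≤N) (C-+ (C-* (rem N) cs) (C-* (quo N ∸ rem N * t) cn))
    where
    s : ℕ
    s = 1 + t * n
    rem quo : ℕ → ℕ
    rem N = N % n
    quo N = N / n
    unfold-s : ∀ k t n → k * (1 + t * n) ≡ k + (k * t) * n
    unfold-s = ℕSolver.solve-∀
    collect : ∀ k a b n → (k + a * n) + b * n ≡ k + (a + b) * n
    collect = ℕSolver.solve-∀
    -- rem N · s ≤ n' · s ≤ N, so comparing quotients by n gives rem N · t ≤ quo N.
    quotient-bound : ∀ N → n' * s ≤ N → rem N * t ≤ quo N
    quotient-bound N B≤N = *-cancelʳ-≤ (rem N * t) (quo N) n (+-cancelˡ-≤ (rem N) _ _ (subst₂ _≤_ (unfold-s (rem N) t n) (m≡m%n+[m/n]*n N n)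
      (≤-trans (*-monoˡ-≤ s (≤-pred (m%n<n N n))) B≤N)))
    decomposition : ∀ N → n' * s ≤ N → rem N * s + (quo N ∸ rem N * t) * n ≡ N
    decomposition N B≤N = begin
      rem N * s + (quo N ∸ rem N * t) * n          ≡⟨ cong (_+ (quo N ∸ rem N * t) * n) (unfold-s (rem N) t n) ⟩
      (rem N + rem N * t * n) + (quo N ∸ rem N * t) * n ≡⟨ collect (rem N) (rem N * t) (quo N ∸ rem N * t) n ⟩
      rem N + (rem N * t + (quo N ∸ rem N * t)) * n  ≡⟨ cong (λ z → rem N + z * n) (m+[n∸m]≡n (quotient-bound N B≤N)) ⟩
      rem N + quo N * n                          ≡⟨ sym (m≡m%n+[m/n]*n N n) ⟩
      N ∎
      where open ≡-Reasoning

one-or-prime-factor : ∀ g → 0 < g → g ≡ 1 ⊎ ∃ λ p → Prime p × p ∣ g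
one-or-prime-factor g@(suc _) _ with factorise g
... | record { factors = [] ; isFactorisation = g≡1 } = inj₁ g≡1
... | record { factors = p ∷ ps ; isFactorisation = g≡Πps ; factorsPrime = p-prime All.∷ _ } =
      inj₂ (p , p-prime , subst (p ∣_) (sym g≡Πps) (m∣m*n (product ps)))

module Companion (m : ℕ) where

  n : ℕ
  n = suc (suc m)

  last : Fin n
  last = fromℕ (suc m)

  toℕ≤last : ∀ (i : Fin n) → toℕ i ≤ suc m
  toℕ≤last = toℕ≤pred[n]

  edge-inversion : ∀ a (i k : Fin n) → Edge n a i k → suc (toℕ i) ≡ toℕ k ⊎ (suc (toℕ i) ≡ n × lookup a k ≡ true)
  edge-inversion a i k e with suc (toℕ i) ≟ toℕ k
  ... | yes step = inj₁ step
  ... | no _ with suc (toℕ i) ≟ n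
  ...   | yes at-last = inj₂ (at-last , e)
  edge-inversion a i k () | no _ | no _

  edge-step : ∀ a (i k : Fin n) → suc (toℕ i) ≡ toℕ k → Edge n a i k
  edge-step a i k step with suc (toℕ i) ≟ toℕ k
  ... | yes _ = refl
  ... | no ¬step = ⊥-elim (¬step step)

  edge-wrap : ∀ a (i k : Fin n) → suc (toℕ i) ≡ n → lookup a k ≡ true → Edge n a i k
  edge-wrap a i k at-last ak with suc (toℕ i) ≟ toℕ k
  ... | yes _ = refl
  ... | no _ with suc (toℕ i) ≟ n
  ...   | yes _ = ak
  ...   | no ¬at-last = ⊥-elim (¬at-last at-last)

  edge-from-last : ∀ a k → lookup a k ≡ true → Edge n a last k
  edge-from-last a k = edge-wrap a last k (cong suc (toℕ-fromℕ (suc m)))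

  walk-up : ∀ a d (i j : Fin n) → toℕ i + d ≡ toℕ j → Walk (Edge n a) d i j
  walk-up a zero    i j i+0≡j = subst (Walk (Edge n a) 0 i) (toℕ-injective (trans (sym (+-identityʳ (toℕ i))) i+0≡j)) nil
  walk-up a (suc d) i j i+d≡j = edge-step a i k (sym (toℕ-fromℕ< i<n)) ∷ʷ walk-up a d k j k+d≡j
    where
    i<n : suc (toℕ i) < n
    i<n = ≤-trans (s≤s (≤-trans (m≤m+n (suc (toℕ i)) d) (≤-reflexive (trans (sym (+-suc (toℕ i) d)) i+d≡j)))) (toℕ<n j)
    k : Fin n
    k = fromℕ< i<n
    k+d≡j : toℕ k + d ≡ toℕ j
    k+d≡j = trans (cong (_+ d) (toℕ-fromℕ< i<n)) (trans (sym (+-suc (toℕ i) d)) i+d≡j)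

  walk-to-last : ∀ a (i : Fin n) → Walk (Edge n a) (suc m ∸ toℕ i) i last
  walk-to-last a i = walk-up a _ i last (trans (m+[n∸m]≡n (toℕ≤last i)) (sym (toℕ-fromℕ (suc m))))

  walk-from-zero : ∀ a (j : Fin n) → Walk (Edge n a) (toℕ j) fzero j
  walk-from-zero a j = walk-up a (toℕ j) fzero j refl

  cycle : ∀ a k → lookup a k ≡ true → Walk (Edge n a) (n ∸ toℕ k) last last
  cycle a k ak = subst (λ r → Walk (Edge n a) r last last) (sym (+-∸-assoc 1 (toℕ≤last k)))
    (edge-from-last a k ak ∷ʷ walk-to-last a k)

  -- D(A) is strongly connected iff a₀ = 1, i.e. the edge last → 0 is present:
  -- then i → … → last → 0 → … → j; conversely only that edge enters vertex 0.
  hasZero⇒irreducible : ∀ a → lookup a fzero ≡ true → Irreducible n a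
  hasZero⇒irreducible a a₀ i j = walk⇒star (walk-to-last a i ++ʷ (edge-from-last a fzero a₀ ∷ʷ walk-from-zero a j))

  irreducible⇒hasZero : ∀ a → Irreducible n a → lookup a fzero ≡ true
  irreducible⇒hasZero a irreducible with star-last-edge (irreducible (fsuc fzero) fzero)
  ... | inj₁ ()
  ... | inj₂ (k , e) with edge-inversion a k fzero e
  ...   | inj₂ (_ , a₀) = a₀

  -- Positive entries of the companion matrix are exactly the edges of D(A), so
  -- primitivity means: walks of one common positive length join all pairs.
  positive⇒edge : ∀ a {i j} → Positive (compMatrix n a) i j → Edge n a i j
  positive⇒edge a {i} {j} pos with compEntry n a i j
  ... | true = refl

  edge⇒positive : ∀ a {i j} → Edge n a i j → Positive (compMatrix n a) i j
  edge⇒positive a e rewrite e = s≤s z≤n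

  primitive⇒walks : ∀ a → Primitive n a → ∃ λ r → ∀ i j → Walk (Edge n a) r i j
  primitive⇒walks a (r , _ , positive) =
    r , λ i j → walk-map (λ {i} {j} → positive⇒edge a {i} {j}) (Equivalence.to (matPow-positive⇔walk (compMatrix n a) r i j) (positive i j))

  walks⇒primitive : ∀ a r → 0 < r → (∀ i j → Walk (Edge n a) r i j) → Primitive n a
  walks⇒primitive a r r>0 walks =
    r , r>0 , λ i j → Equivalence.from (matPow-positive⇔walk (compMatrix n a) r i j) (walk-map (λ {i} {j} → edge⇒positive a {i} {j}) (walks i j))

  -- If p ≥ 2 divides every cycle length, each edge i → k satisfies k ≡ i + 1 (mod p),
  -- so a walk of length r from i ends at i + r (mod p); the walks 0 → 0 and 0 → 1
  -- can then never have a common length.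
  module Periodic (a : Vec Bool n) (p' : ℕ) (p-divides : CycleDivisor (suc (suc p')) a) where

    p : ℕ
    p = suc (suc p')

    edge-mod : ∀ i k → Edge n a i k → suc (toℕ i) % p ≡ toℕ k % p
    edge-mod i k e with edge-inversion a i k e
    ... | inj₁ step = cong (_% p) step
    ... | inj₂ (at-last , ak) =
      trans (cong (_% p) (trans at-last (sym (m∸n+n≡m (toℕ≤n k))))) (%-remove-+ˡ (toℕ k) (p-divides k ak))

    walk-mod : ∀ {r i j} → Walk (Edge n a) r i j → (toℕ i + r) % p ≡ toℕ j % p
    walk-mod {i = i} nil = cong (_% p) (+-identityʳ (toℕ i))
    walk-mod {suc r} {i} {j} (_∷ʷ_ {y = k} e w) = begin
      (toℕ i + suc r) % p                    ≡⟨ cong (_% p) (+-suc (toℕ i) r) ⟩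
      (suc (toℕ i) + r) % p                  ≡⟨ %-distribˡ-+ (suc (toℕ i)) r p ⟩
      (suc (toℕ i) % p + r % p) % p          ≡⟨ cong (λ x → (x + r % p) % p) (edge-mod i k e) ⟩
      (toℕ k % p + r % p) % p                ≡⟨ %-distribˡ-+ (toℕ k) r p ⟨
      (toℕ k + r) % p                        ≡⟨ walk-mod w ⟩
      toℕ j % p                              ∎
      where open ≡-Reasoning

    ¬primitive : ¬ Primitive n a
    ¬primitive prim with primitive⇒walks a prim
    ... | r , walks with trans (sym (walk-mod (walks fzero fzero))) (walk-mod (walks fzero (fsuc fzero)))
    ...   | 0≡1%p with trans 0≡1%p (m<n⇒m%n≡m {n = p} (s≤s (s≤s z≤n)))
    ...     | ()

  cycleDivisor⇒¬primitive : ∀ a p → 1 < p → CycleDivisor p a → ¬ Primitive n a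
  cycleDivisor⇒¬primitive a (suc (suc p')) (s≤s (s≤s z≤n)) p-divides = Periodic.¬primitive a p' p-divides

  Closed : Vec Bool n → ℕ → Set
  Closed a r = Walk (Edge n a) r last last

  cycleLengths : Vec Bool n → List ℕ
  cycleLengths a = map (λ k → n ∸ toℕ k) (filterᵇ (lookup a) (allFin n))

  ∈-cycleLengths⁺ : ∀ a k → lookup a k ≡ true → n ∸ toℕ k ∈ cycleLengths a
  ∈-cycleLengths⁺ a k ak = ∈-map⁺ _ (∈-filter⁺ (T? ∘ lookup a) (∈-allFin k) (Equivalence.from T-≡ ak))

  ∈-cycleLengths⁻ : ∀ a {d} → d ∈ cycleLengths a → ∃ λ k → lookup a k ≡ true × d ≡ n ∸ toℕ k
  ∈-cycleLengths⁻ a d∈ with ∈-map⁻ _ d∈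
  ... | k , k∈ , d≡ = k , Equivalence.to T-≡ (proj₂ (∈-filter⁻ (T? ∘ lookup a) k∈)) , d≡

  -- Closed walks through last of every length ≥ B make A primitive: with r = B + 2n,
  -- join i to j by i → … → last, a closed walk filling up the length r, then
  -- last → 0 → … → j.
  eventually⇒primitive : ∀ a → lookup a fzero ≡ true → ∀ B → (∀ N → B ≤ N → Closed a N) → Primitive n a
  eventually⇒primitive a a₀ B closed = walks⇒primitive a r (≤-trans (s≤s z≤n) (m≤n+m (n + n) B)) walk
    where
    r : ℕ
    r = B + (n + n)
    walk : ∀ i j → Walk (Edge n a) r i j
    walk i j = subst (λ l → Walk (Edge n a) l i j) length-r
      (walk-to-last a i ++ʷ (closed (r ∸ detour) B≤rest ++ʷ (edge-from-last a fzero a₀ ∷ʷ walk-from-zero a j)))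
      where
      detour : ℕ
      detour = (suc m ∸ toℕ i) + suc (toℕ j)
      detour≤2n : detour ≤ n + n
      detour≤2n = +-mono-≤ (≤-trans (m∸n≤m (suc m) (toℕ i)) (n≤1+n (suc m))) (toℕ<n j)
      B≤rest : B ≤ r ∸ detour
      B≤rest = subst (B ≤_) (sym (+-∸-assoc B detour≤2n)) (m≤m+n B _)
      length-r : (suc m ∸ toℕ i) + ((r ∸ detour) + suc (toℕ j)) ≡ r
      length-r = trans (shuffle (suc m ∸ toℕ i) (r ∸ detour) (suc (toℕ j))) (m∸n+n≡m (≤-trans detour≤2n (m≤n+m (n + n) B)))
        where
        shuffle : ∀ x c y → x + (c + y) ≡ c + (x + y)
        shuffle = ℕSolver.solve-∀

  gcdCycles : Vec Bool n → ℕ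
  gcdCycles a = gcdList (cycleLengths a)

  gcdCycles-divides : ∀ a → CycleDivisor (gcdCycles a) a
  gcdCycles-divides a k ak = gcdList-∣ (∈-cycleLengths⁺ a k ak)

  gcdCycles-positive : ∀ a → lookup a fzero ≡ true → 0 < gcdCycles a
  gcdCycles-positive a a₀ = ∣⇒positive (gcdCycles-divides a fzero a₀)
    where
    ∣⇒positive : ∀ {g} → g ∣ n → 0 < g
    ∣⇒positive {zero}  0∣n = ⊥-elim (1+n≢0 (0∣⇒≡0 0∣n))
    ∣⇒positive {suc _} _   = s≤s z≤n

  module _ (a : Vec Bool n) where

    open AdditivelyClosed (Closed a) nil _++ʷ_ (suc m) using (Residue; residue; residue-gcdList; eventually)

    gcdCycles-realised : Residue (gcdCycles a)
    gcdCycles-realised = residue-gcdList (All.tabulate λ d∈ → residue-of-cycle (∈-cycleLengths⁻ a d∈))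
      where
      residue-of-cycle : ∀ {d} → (∃ λ k → lookup a k ≡ true × d ≡ n ∸ toℕ k) → Residue d
      residue-of-cycle (k , ak , refl) = residue (cycle a k ak)

    -- If no prime factor of n divides all cycle lengths, D(A) is primitive: their
    -- gcd, lacking prime factors, is 1; so 1 is realised modulo n by a closed walk,
    -- and then closed walks of every large length exist.
    aperiodic⇒primitive : lookup a fzero ≡ true → (∀ p → Prime p → p ∣ n → ¬ CycleDivisor p a) → Primitive n a
    aperiodic⇒primitive a₀ aperiodic with one-or-prime-factor (gcdCycles a) (gcdCycles-positive a a₀)
    ... | inj₁ g≡1 =
      uncurry (eventually⇒primitive a a₀) (eventually (cycle a fzero a₀) (subst Residue g≡1 gcdCycles-realised))
    ... | inj₂ (p , p-prime , p∣g) = ⊥-elim (aperiodic p p-prime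
      (∣-trans p∣g (gcdCycles-divides a fzero a₀)) (λ k ak → ∣-trans p∣g (gcdCycles-divides a k ak)))

  -- Classification: A is irreducible but not primitive iff a₀ = 1 and some prime
  -- factor p of n divides every cycle length (the marked positions of a are
  -- multiples of p).
  classification : ∀ ps → DistinctPrimeFactors n ps → ∀ a →
    T (lookup a fzero ∧ any (λ p → does (a ⊆? multiples p n)) ps) ⇔ (Irreducible n a × ¬ Primitive n a)
  classification ps (_ , prime-factors) a = mk⇔ to from
    where
    Periodicᵇ : Bool
    Periodicᵇ = any (λ p → does (a ⊆? multiples p n)) ps

    periodic-sound : T Periodicᵇ → ∃ λ p → Prime p × CycleDivisor p a
    periodic-sound periodic with find (any⁻ _ ps periodic)
    ... | p , p∈ps , a⊆ = p , proj₁ (Equivalence.to (prime-factors p) p∈ps) ,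
                          Equivalence.to (⊆-multiples⇔ p a) (does-sound (a ⊆? multiples p n) a⊆)

    periodic-complete : ∀ p → Prime p → p ∣ n → CycleDivisor p a → T Periodicᵇ
    periodic-complete p p-prime p∣n p-divides = any⁺ _ (Any.map (λ { refl →
      does-complete (a ⊆? multiples p n) (Equivalence.from (⊆-multiples⇔ p a) p-divides) })
      (Equivalence.from (prime-factors p) (p-prime , p∣n)))

    to : T (lookup a fzero ∧ Periodicᵇ) → Irreducible n a × ¬ Primitive n a
    to χ with Equivalence.to T-∧ χ
    ... | a₀ , periodic with periodic-sound periodic
    ...   | p , p-prime , p-divides =
      hasZero⇒irreducible a (Equivalence.to T-≡ a₀) ,
      cycleDivisor⇒¬primitive a p (nonTrivial⇒n>1 p {{prime⇒nonTrivial p-prime}}) p-divides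

    from : Irreducible n a × ¬ Primitive n a → T (lookup a fzero ∧ Periodicᵇ)
    from (irreducible , ¬primitive) with irreducible⇒hasZero a irreducible | T? Periodicᵇ
    ... | a₀ | yes periodic = Equivalence.from T-∧ (Equivalence.from T-≡ a₀ , periodic)
    ... | a₀ | no aperiodic = ⊥-elim (¬primitive (aperiodic⇒primitive a a₀
      λ p p-prime p∣n p-divides → aperiodic (periodic-complete p p-prime p∣n p-divides)))

subsets-sound : ∀ {ps S} → Unique ps → S ∈ subsets ps → Unique S × All (_∈ ps) S
subsets-sound {[]} _ (here refl) = [] , []
subsets-sound {x ∷ ps} (x∉ps ∷ unique) S∈ with ∈-++⁻ (subsets ps) S∈
... | inj₁ S∈ps with subsets-sound unique S∈ps
...   | unique-S , S⊆ps = unique-S , All.map there S⊆ps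
subsets-sound {x ∷ ps} (x∉ps ∷ unique) S∈ | inj₂ xS∈ with ∈-map⁻ (x ∷_) xS∈
... | S , S∈ps , refl with subsets-sound unique S∈ps
...   | unique-S , S⊆ps =
  All.map (λ y∈ps x≡y → All.lookup x∉ps y∈ps x≡y) S⊆ps ∷ unique-S , here refl ∷ All.map there S⊆ps

parity : ∀ k → -1ℤ ℤ.^ k ≡ -1ℤ ℤ.^ (suc k + 1)
parity 0       = refl
parity (suc k) = cong (-1ℤ ℤ.*_) (parity k)

module PrimeFactorCount (m : ℕ) (ps : List ℕ) (dpf : DistinctPrimeFactors (suc (suc m)) ps) where

  open Companion m using (n)
  open InclusionExclusion (allVectors n) (λ p a → does (a ⊆? multiples p n)) public

  hasZero : Vec Bool n → Bool
  hasZero a = lookup a fzero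

  -- The k-th inclusion–exclusion term is the one of the stated formula: for a
  -- selection S of prime factors, the rows counted are those of the divisor ∏ S.
  unionTerm≡term : ∀ {S} → S ∈ subsets ps → unionTerm hasZero S ≡ term n S
  unionTerm≡term {[]}    _    = refl
  unionTerm≡term {x ∷ S} x∷S∈ with subsets-sound (proj₁ dpf) x∷S∈
  ... | unique-S , in-ps = cong₂ ℤ._*_ (parity (length S)) (cong +_ count-eq)
    where
    primes : All Prime (x ∷ S)
    primes = All.map (λ p∈ → proj₁ (Equivalence.to (proj₂ dpf _) p∈)) in-ps
    divisors : All (_∣ n) (x ∷ S)
    divisors = All.map (λ p∈ → proj₂ (Equivalence.to (proj₂ dpf _) p∈)) in-ps
    count-eq : count (λ a → (hasZero a ∧ does (a ⊆? multiples x n)) ∧ allOf S a) (allVectors n) ≡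
               2 ^ (quot n (product (x ∷ S)) ∸ 1)
    count-eq = trans
      (count-cong (allVectors n) λ a → trans (∧-assoc (hasZero a) _ _) (cong (hasZero a ∧_) (all-multiples (x ∷ S) unique-S primes a)))
      (count-multiples (product (x ∷ S)) (suc m) (product-∣ unique-S primes divisors) (productOfPrimes≥1 primes))

-- χ picks out exactly the irreducible, non-primitive last rows (classification);
-- counting them by inclusion–exclusion gives the stated formula term by term.
mainTheorem1 : (n : ℕ) → 3 ≤ n → (ps : List ℕ) → DistinctPrimeFactors n ps →
    Σ ℕ λ N → HasCard (λ (a : Vec Bool n) → Irreducible n a × ¬ Primitive n a) N ×
      (+ N ≡ inclExcl n ps)
mainTheorem1 (suc (suc (suc m))) (s≤s (s≤s (s≤s z≤n))) ps dpf =
  count χ (allVectors n) ,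
  hasCard-count (allVectors-unique n) allVectors-complete (classification ps dpf) ,
  (begin
    + count χ (allVectors n)                     ≡⟨ inclusionExclusion hasZero ps ⟩
    sumℤ (map (unionTerm hasZero) (subsets ps))  ≡⟨ cong sumℤ (map-cong-local (All.tabulate unionTerm≡term)) ⟩
    inclExcl n ps                                ∎)
  where
  open Companion (suc m) using (n; classification)
  open PrimeFactorCount (suc m) ps dpf
  open ≡-Reasoning
  χ : Vec Bool n → Bool
  χ a = hasZero a ∧ anyOf ps a
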